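{- Let $(X,Y,\phi)$ be an $L$-context and $X'\subseteq X$, $Y'\subseteq Y$. Then $(X',Y',\phi_{X',Y'})$ is a reduct of $(X,Y,\phi)$ in RST if and only if both $X\setminus X'$ and $Y\setminus Y'$ are $\phi$-reducible in RST.
   Context: $L=(L,*)$ is a complete residuated lattice: a complete lattice with bottom $0$ and top $1$ with a commutative monoid operation $*$ with unit $1$ satisfying $a*\bigvee_i b_i=\bigvee_i a*b_i$; $\rightarrow$ is its residuum ($a*b\le c\iff a\le b\rightarrow c$). An $L$-context is $(X,Y,\phi)$ with $\phi\colon X\times Y\to L$. $L^X$ is the set of maps $X\to L$ with $L$-order $L^X(\mu,\mu')=\bigwedge_x\mu(x)\rightarrow\mu'(x)$, inherited by subsets. Define $\phi^\exists\colon L^X\to L^Y$, $\phi^\exists(\mu)(y)=\bigvee_x\mu(x)*\phi(x,y)$, $\phi^\forall\colon L^Y\to L^X$, $\phi^\forall(\lambda)(x)=\bigwedge_y\phi(x,y)\rightarrow\lambda(y)$, and $\mathcal K\phi=\{\mu\in L^X:\phi^\forall\phi^\exists\mu=\mu\}$. $\phi_{X',Y'}$ is the restriction of $\phi$ to $X'\times Y'$; $\mu_{X'}$ is the restriction of $\mu\in L^X$ to $X'$; for $\mu'\in L^{X'}$, $\underline{\mu'}\in L^X$ extends $\mu'$ by $0$. Maps: $S_1,S_2\colon\mathcal K\phi\to\mathcal K\phi_{X',Y'}$, $S_1\mu=(\phi_{X',Y'})^\forall(\phi_{X',Y'})^\exists\mu_{X'}$, $S_2\mu=((\phi_{X,Y'})^\forall(\phi_{X,Y'})^\exists\mu)_{X'}$;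 $F_1,F_2\colon\mathcal K\phi_{X',Y'}\to\mathcal K\phi$, $F_1\mu'=\phi^\forall\phi^\exists\underline{\mu'}$, $F_2\mu'=(\phi_{X,Y'})^\forall(\phi_{X,Y'})^\exists\underline{\mu'}$. An isomorphism is a bijection $h$ with $L^A(p,p')=L^B(hp,hp')$. One of $S_1,S_2,F_1,F_2$ is an isomorphism iff all are, and $(X',Y',\phi_{X',Y'})$ is a reduct of $(X,Y,\phi)$ in RST if any one (hence each) of them is an isomorphism. $X\setminus X'$ is $\phi$-reducible in RST if for every $\mu\in L^X$ there is $\mu'\in L^{X'}$ with $\phi^\exists\mu=(\phi_{X',Y})^\exists\mu'$; $Y\setminus Y'$ is $\phi$-reducible in RST if for every $\lambda\in L^Y$ there is $\lambda'\in L^{Y'}$ with $\phi^\forall\lambda=(\phi_{X,Y'})^\forall\lambda'$. -}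

module Defs where

open import Data.Product using (Σ; ∃; _×_; _,_; proj₁; proj₂)
open import Data.Sum using (_⊎_)
open import Data.Empty using (⊥)
open import Relation.Binary.PropositionalEquality using (_≡_)

record CompleteResiduatedLattice : Set₁ where
  infix  4 _≤_
  infixl 7 _*_
  infixr 5 _⇒_
  field
    Carrier   : Set
    _≤_       : Carrier → Carrier → Set
    ≤-refl    : ∀ {a} → a ≤ a
    ≤-trans   : ∀ {a b c} → a ≤ b → b ≤ c → a ≤ c
    ≤-antisym : ∀ {a b} → a ≤ b → b ≤ a → a ≡ b
    ⋁         : {I : Set} → (I → Carrier) → Carrier
    ⋁-upper   : {I : Set} (f : I → Carrier) (i : I) → f i ≤ ⋁ f
    ⋁-least   : {I : Set} (f : I → Carrier) (a : Carrier) → (∀ i → f i ≤ a) → ⋁ f ≤ a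
    ⋀         : {I : Set} → (I → Carrier) → Carrier
    ⋀-lower   : {I : Set} (f : I → Carrier) (i : I) → ⋀ f ≤ f i
    ⋀-greatest : {I : Set} (f : I → Carrier) (a : Carrier) → (∀ i → a ≤ f i) → a ≤ ⋀ f
    𝟙         : Carrier
    𝟙-top     : ∀ a → a ≤ 𝟙
    _*_       : Carrier → Carrier → Carrier
    *-assoc   : ∀ a b c → (a * b) * c ≡ a * (b * c)
    *-comm    : ∀ a b → a * b ≡ b * a
    *-identityʳ : ∀ a → a * 𝟙 ≡ a
    *-distrib-⋁ : ∀ a {I : Set} (f : I → Carrier) → a * ⋁ f ≡ ⋁ (λ i → a * f i)
    _⇒_       : Carrier → Carrier → Carrier
    residual→ : ∀ {a b c} → a * b ≤ c → a ≤ b ⇒ c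
    residual← : ∀ {a b c} → a ≤ b ⇒ c → a * b ≤ c

  𝟘 : Carrier
  𝟘 = ⋁ {⊥} (λ ())

module Context (L : CompleteResiduatedLattice) where
  open CompleteResiduatedLattice L

  LSet : Set → Set
  LSet X = X → Carrier

  _≈_ : {X : Set} → LSet X → LSet X → Set
  μ ≈ ν = ∀ x → μ x ≡ ν x

  Sub : {X : Set} → LSet X → LSet X → Carrier
  Sub {X} μ ν = ⋀ {X} (λ x → μ x ⇒ ν x)

  up : {X Y : Set} → (X → Y → Carrier) → LSet X → LSet Y
  up {X} φ μ y = ⋁ {X} (λ x → μ x * φ x y)

  down : {X Y : Set} → (X → Y → Carrier) → LSet Y → LSet X
  down {X} {Y} φ λ' x = ⋀ {Y} (λ y → φ x y ⇒ λ' y)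

  clo : {X Y : Set} → (X → Y → Carrier) → LSet X → LSet X
  clo φ μ = down φ (up φ μ)

  InK : {X Y : Set} → (X → Y → Carrier) → LSet X → Set
  InK φ μ = clo φ μ ≈ μ

  Sub⟨_⟩ : {X : Set} → (X → Set) → Set
  Sub⟨_⟩ {X} P = Σ X P

  restr : {X Y : Set} (P : X → Set) (Q : Y → Set) → (X → Y → Carrier)
        → Sub⟨ P ⟩ → Sub⟨ Q ⟩ → Carrier
  restr P Q φ (x , _) (y , _) = φ x y

  restrY : {X Y : Set} (Q : Y → Set) → (X → Y → Carrier) → X → Sub⟨ Q ⟩ → Carrier
  restrY Q φ x (y , _) = φ x y

  restrX : {X Y : Set} (P : X → Set) → (X → Y → Carrier) → Sub⟨ P ⟩ → Y → Carrier
  restrX P φ (x , _) y = φ x y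

  restrict : {X : Set} (P : X → Set) → LSet X → LSet Sub⟨ P ⟩
  restrict P μ (x , _) = μ x

  -- extension by 0: value μ'(x) if x ∈ X', 0 otherwise
  -- (written as a join over membership proofs; P is proof-irrelevant)
  extend : {X : Set} (P : X → Set) → LSet Sub⟨ P ⟩ → LSet X
  extend {X} P μ' x = ⋁ {P x} (λ p → μ' (x , p))

  module Maps {X Y : Set} (φ : X → Y → Carrier) (P : X → Set) (Q : Y → Set) where
    φ' : Sub⟨ P ⟩ → Sub⟨ Q ⟩ → Carrier
    φ' = restr P Q φ

    S₁ : LSet X → LSet Sub⟨ P ⟩
    S₁ μ = clo φ' (restrict P μ)

    S₂ : LSet X → LSet Sub⟨ P ⟩
    S₂ μ = restrict P (clo (restrY Q φ) μ)

    F₁ : LSet Sub⟨ P ⟩ → LSet X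
    F₁ μ' = clo φ (extend P μ')

    F₂ : LSet Sub⟨ P ⟩ → LSet X
    F₂ μ' = clo (restrY Q φ) (extend P μ')

  IsIso : {A B C D : Set} (ψ : A → B → Carrier) (χ : C → D → Carrier)
        → (LSet A → LSet C) → Set
  IsIso {A} {B} {C} {D} ψ χ h =
      (∀ p → InK ψ p → InK χ (h p))
    × (∀ p p' → InK ψ p → InK ψ p' → h p ≈ h p' → p ≈ p')
    × (∀ q → InK χ q → Σ (LSet A) (λ p → InK ψ p × (h p ≈ q)))
    × (∀ p p' → InK ψ p → InK ψ p' → Sub p p' ≡ Sub (h p) (h p'))

  IsReduct : {X Y : Set} (φ : X → Y → Carrier) (P : X → Set) (Q : Y → Set) → Set
  IsReduct φ P Q =
      IsIso φ (restr P Q φ) S₁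
    ⊎ IsIso φ (restr P Q φ) S₂
    ⊎ IsIso (restr P Q φ) φ F₁
    ⊎ IsIso (restr P Q φ) φ F₂
    where open Maps φ P Q

  XReducible : {X Y : Set} (φ : X → Y → Carrier) (P : X → Set) → Set
  XReducible {X} φ P =
    ∀ (μ : LSet X) → Σ (LSet Sub⟨ P ⟩) (λ μ' → up φ μ ≈ up (restrX P φ) μ')

  YReducible : {X Y : Set} (φ : X → Y → Carrier) (Q : Y → Set) → Set
  YReducible {X} {Y} φ Q =
    ∀ (λ' : LSet Y) → Σ (LSet Sub⟨ Q ⟩) (λ λ'' → down φ λ' ≈ down (restrY Q φ) λ'')

{-# OPTIONS --safe #-}
-- F₁ is always an order embedding of 𝒦φ_{X',Y'} into 𝒦φ: for ν ∈ 𝒦φ_{X',Y'} we have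
-- F₁ ν ⊑ F₂ ν, and the restriction of F₂ ν to X' is φ_{X',Y'}^∀φ_{X',Y'}^∃ ν = ν. So
-- (X',Y',φ_{X',Y'}) is a reduct exactly when F₁ is onto 𝒦φ. That in turn means that every
-- μ ∈ 𝒦φ is the closure of its restriction to X' (equivalent to X∖X' being reducible)
-- and is already closed for φ_{X,Y'} (equivalent to Y∖Y' being reducible). Each of
-- S₁, S₂, F₂ being an isomorphism forces the same two conditions, through injectivity
-- or surjectivity alone.
module Submission where

open import Defs
open import Data.Product using (_×_; Σ; _,_)
open import Data.Sum using (inj₁; inj₂)
open import Function.Bundles using (_⇔_; mk⇔)
open import Level using (0ℓ)
open import Relation.Binary.Bundles using (Poset)
open import Relation.Binary.PropositionalEquality
  using (_≡_; refl; sym; trans; cong₂; isEquivalence)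
import Relation.Binary.Reasoning.PartialOrder as PartialOrderReasoning

module _ (L : CompleteResiduatedLattice) where
  open CompleteResiduatedLattice L
  open Context L

  ≤-reflexive : ∀ {a b} → a ≡ b → a ≤ b
  ≤-reflexive refl = ≤-refl

  ≤-poset : Poset 0ℓ 0ℓ 0ℓ
  ≤-poset = record
    { _≈_            = _≡_
    ; _≤_            = _≤_
    ; isPartialOrder = record
      { isPreorder = record
        { isEquivalence = isEquivalence
        ; reflexive     = ≤-reflexive
        ; trans         = ≤-trans
        }
      ; antisym    = ≤-antisym
      }
    }

  module ≤-Reasoning = PartialOrderReasoning ≤-poset

  *-monoˡ-≤ : ∀ {a b} c → a ≤ b → a * c ≤ b * c
  *-monoˡ-≤ c a≤b = residual← (≤-trans a≤b (residual→ ≤-refl))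

  *-monoʳ-≤ : ∀ c {a b} → a ≤ b → c * a ≤ c * b
  *-monoʳ-≤ c {a} {b} a≤b = begin
    c * a  ≡⟨ *-comm c a ⟩
    a * c  ≤⟨ *-monoˡ-≤ c a≤b ⟩
    b * c  ≡⟨ *-comm b c ⟩
    c * b  ∎
    where open ≤-Reasoning

  ⇒-eval : ∀ a b → (a ⇒ b) * a ≤ b
  ⇒-eval a b = residual← ≤-refl

  ⇒-monoʳ-≤ : ∀ a {b b'} → b ≤ b' → (a ⇒ b) ≤ (a ⇒ b')
  ⇒-monoʳ-≤ a {b} b≤b' = residual→ (≤-trans (⇒-eval a b) b≤b')

  ⋁-mono : ∀ {I : Set} {f g : I → Carrier} → (∀ i → f i ≤ g i) → ⋁ f ≤ ⋁ g
  ⋁-mono {f = f} {g} f≤g = ⋁-least f (⋁ g) (λ i → ≤-trans (f≤g i) (⋁-upper g i))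

  ⋀-mono : ∀ {I : Set} {f g : I → Carrier} → (∀ i → f i ≤ g i) → ⋀ f ≤ ⋀ g
  ⋀-mono {f = f} {g} f≤g = ⋀-greatest g (⋀ f) (λ i → ≤-trans (⋀-lower f i) (f≤g i))

  ⋁-cong : ∀ {I : Set} {f g : I → Carrier} → (∀ i → f i ≡ g i) → ⋁ f ≡ ⋁ g
  ⋁-cong f≡g = ≤-antisym (⋁-mono (λ i → ≤-reflexive (f≡g i)))
                         (⋁-mono (λ i → ≤-reflexive (sym (f≡g i))))

  ⋀-cong : ∀ {I : Set} {f g : I → Carrier} → (∀ i → f i ≡ g i) → ⋀ f ≡ ⋀ g
  ⋀-cong f≡g = ≤-antisym (⋀-mono (λ i → ≤-reflexive (f≡g i)))
                         (⋀-mono (λ i → ≤-reflexive (sym (f≡g i))))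

  ⋁-*-least : ∀ {I : Set} (f : I → Carrier) {c d} → (∀ i → f i * c ≤ d) → ⋁ f * c ≤ d
  ⋁-*-least f {c} {d} f*c≤d = residual← (⋁-least f (c ⇒ d) (λ i → residual→ (f*c≤d i)))

  *-⋁-least : ∀ {I : Set} (f : I → Carrier) {c d} → (∀ i → c * f i ≤ d) → c * ⋁ f ≤ d
  *-⋁-least f {c} {d} c*f≤d = begin
    c * ⋁ f              ≡⟨ *-distrib-⋁ c f ⟩
    ⋁ (λ i → c * f i)    ≤⟨ ⋁-least _ d c*f≤d ⟩
    d                    ∎
    where open ≤-Reasoning

  infix 4 _⊑_

  _⊑_ : {X : Set} → LSet X → LSet X → Set
  μ ⊑ ν = ∀ x → μ x ≤ ν x

  ⊑-refl : {X : Set} {μ : LSet X} → μ ⊑ μ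
  ⊑-refl x = ≤-refl

  ⊑-antisym : {X : Set} {μ ν : LSet X} → μ ⊑ ν → ν ⊑ μ → μ ≈ ν
  ⊑-antisym μ⊑ν ν⊑μ x = ≤-antisym (μ⊑ν x) (ν⊑μ x)

  ≈-sym : {X : Set} {μ ν : LSet X} → μ ≈ ν → ν ≈ μ
  ≈-sym μ≈ν x = sym (μ≈ν x)

  ≈-trans : {X : Set} {μ ν ρ : LSet X} → μ ≈ ν → ν ≈ ρ → μ ≈ ρ
  ≈-trans μ≈ν ν≈ρ x = trans (μ≈ν x) (ν≈ρ x)

  ⊑-poset : Set → Poset 0ℓ 0ℓ 0ℓ
  ⊑-poset X = record
    { Carrier        = LSet X
    ; _≈_            = _≈_
    ; _≤_            = _⊑_
    ; isPartialOrder = record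
      { isPreorder = record
        { isEquivalence = record { refl = λ x → refl ; sym = ≈-sym ; trans = ≈-trans }
        ; reflexive     = λ μ≈ν x → ≤-reflexive (μ≈ν x)
        ; trans         = λ μ⊑ν ν⊑ρ x → ≤-trans (μ⊑ν x) (ν⊑ρ x)
        }
      ; antisym    = ⊑-antisym
      }
    }

  module ⊑-Reasoning {X : Set} = PartialOrderReasoning (⊑-poset X)

  Sub-intro : {X : Set} {s : Carrier} {μ ν : LSet X} → (∀ x → s * μ x ≤ ν x) → s ≤ Sub μ ν
  Sub-intro s*μ≤ν = ⋀-greatest _ _ (λ x → residual→ (s*μ≤ν x))

  Sub-eval : {X : Set} (μ ν : LSet X) (x : X) → Sub μ ν * μ x ≤ ν x
  Sub-eval μ ν x = residual← (⋀-lower (λ x → μ x ⇒ ν x) x)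

  Sub-cong : {X : Set} {μ μ' ν ν' : LSet X} → μ ≈ μ' → ν ≈ ν' → Sub μ ν ≡ Sub μ' ν'
  Sub-cong μ≈μ' ν≈ν' = ⋀-cong (λ x → cong₂ _⇒_ (μ≈μ' x) (ν≈ν' x))

  module _ {X Y : Set} (φ : X → Y → Carrier) where

    down-eval : (l : LSet Y) (x : X) (y : Y) → down φ l x * φ x y ≤ l y
    down-eval l x y = ≤-trans (*-monoˡ-≤ (φ x y) (⋀-lower (λ y → φ x y ⇒ l y) y))
                              (⇒-eval (φ x y) (l y))

    up-mono : {μ ν : LSet X} → μ ⊑ ν → up φ μ ⊑ up φ ν
    up-mono μ⊑ν y = ⋁-mono (λ x → *-monoˡ-≤ (φ x y) (μ⊑ν x))

    down-mono : {l l' : LSet Y} → l ⊑ l' → down φ l ⊑ down φ l'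
    down-mono l⊑l' x = ⋀-mono (λ y → ⇒-monoʳ-≤ (φ x y) (l⊑l' y))

    clo-mono : {μ ν : LSet X} → μ ⊑ ν → clo φ μ ⊑ clo φ ν
    clo-mono μ⊑ν = down-mono (up-mono μ⊑ν)

    up-cong : {μ ν : LSet X} → μ ≈ ν → up φ μ ≈ up φ ν
    up-cong μ≈ν y = ⋁-cong (λ x → cong₂ _*_ (μ≈ν x) refl)

    down-cong : {l l' : LSet Y} → l ≈ l' → down φ l ≈ down φ l'
    down-cong l≈l' x = ⋀-cong (λ y → cong₂ _⇒_ refl (l≈l' y))

    clo-cong : {μ ν : LSet X} → μ ≈ ν → clo φ μ ≈ clo φ ν
    clo-cong μ≈ν = down-cong (up-cong μ≈ν)

    clo-extensive : (μ : LSet X) → μ ⊑ clo φ μ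
    clo-extensive μ x = ⋀-greatest _ _ (λ y → residual→ (⋁-upper (λ x' → μ x' * φ x' y) x))

    up∘down⊑id : (l : LSet Y) → up φ (down φ l) ⊑ l
    up∘down⊑id l y = ⋁-least _ _ (λ x → down-eval l x y)

    down-closed : (l : LSet Y) → InK φ (down φ l)
    down-closed l = ⊑-antisym (down-mono (up∘down⊑id l)) (clo-extensive (down φ l))

    clo-closed : (μ : LSet X) → InK φ (clo φ μ)
    clo-closed μ = down-closed (up φ μ)

    up∘clo≈up : (μ : LSet X) → up φ (clo φ μ) ≈ up φ μ
    up∘clo≈up μ = ⊑-antisym (up∘down⊑id (up φ μ)) (up-mono (clo-extensive μ))

    InK-resp : {μ ν : LSet X} → μ ≈ ν → InK φ μ → InK φ ν
    InK-resp μ≈ν closed = ≈-trans (clo-cong (≈-sym μ≈ν)) (≈-trans closed μ≈ν)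

    Sub-up : (μ μ' : LSet X) → Sub μ μ' ≤ Sub (up φ μ) (up φ μ')
    Sub-up μ μ' = Sub-intro λ y → *-⋁-least _ λ x → begin
      s * (μ x * φ x y)  ≡⟨ *-assoc s (μ x) (φ x y) ⟨
      s * μ x * φ x y    ≤⟨ *-monoˡ-≤ (φ x y) (Sub-eval μ μ' x) ⟩
      μ' x * φ x y       ≤⟨ ⋁-upper (λ x → μ' x * φ x y) x ⟩
      up φ μ' y          ∎
      where open ≤-Reasoning
            s = Sub μ μ'

    Sub-down : (l l' : LSet Y) → Sub l l' ≤ Sub (down φ l) (down φ l')
    Sub-down l l' = Sub-intro λ x → ⋀-greatest _ _ λ y → residual→ (begin
      s * down φ l x * φ x y    ≡⟨ *-assoc s (down φ l x) (φ x y) ⟩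
      s * (down φ l x * φ x y)  ≤⟨ *-monoʳ-≤ s (down-eval l x y) ⟩
      s * l y                   ≤⟨ Sub-eval l l' y ⟩
      l' y                      ∎)
      where open ≤-Reasoning
            s = Sub l l'

    Sub-clo : (μ μ' : LSet X) → Sub μ μ' ≤ Sub (clo φ μ) (clo φ μ')
    Sub-clo μ μ' = ≤-trans (Sub-up μ μ') (Sub-down (up φ μ) (up φ μ'))

  module _ {X : Set} (P : X → Set) where

    restrict-mono : {μ μ' : LSet X} → μ ⊑ μ' → restrict P μ ⊑ restrict P μ'
    restrict-mono μ⊑μ' (x , _) = μ⊑μ' x

    restrict-cong : {μ μ' : LSet X} → μ ≈ μ' → restrict P μ ≈ restrict P μ'
    restrict-cong μ≈μ' (x , _) = μ≈μ' x

    extend-mono : {ν ν' : LSet Sub⟨ P ⟩} → ν ⊑ ν' → extend P ν ⊑ extend P ν'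
    extend-mono ν⊑ν' x = ⋁-mono (λ p → ν⊑ν' (x , p))

    extend-cong : {ν ν' : LSet Sub⟨ P ⟩} → ν ≈ ν' → extend P ν ≈ extend P ν'
    extend-cong ν≈ν' x = ⋁-cong (λ p → ν≈ν' (x , p))

    ⊑-restrict⇒extend-⊑ : {ν : LSet Sub⟨ P ⟩} {μ : LSet X} →
                          ν ⊑ restrict P μ → extend P ν ⊑ μ
    ⊑-restrict⇒extend-⊑ ν⊑μ x = ⋁-least _ _ (λ p → ν⊑μ (x , p))

    extend∘restrict⊑ : (μ : LSet X) → extend P (restrict P μ) ⊑ μ
    extend∘restrict⊑ μ = ⊑-restrict⇒extend-⊑ ⊑-refl

    extend-⊑⇒⊑-restrict : {ν : LSet Sub⟨ P ⟩} {μ : LSet X} →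
                          extend P ν ⊑ μ → ν ⊑ restrict P μ
    extend-⊑⇒⊑-restrict {ν} ν⊑μ (x , p) =
      ≤-trans (⋁-upper (λ p → ν (x , p)) p) (ν⊑μ x)

    Sub-restrict : (μ μ' : LSet X) → Sub μ μ' ≤ Sub (restrict P μ) (restrict P μ')
    Sub-restrict μ μ' = ⋀-greatest _ _ (λ { (x , _) → ⋀-lower (λ x → μ x ⇒ μ' x) x })

    Sub-extend : (ν ν' : LSet Sub⟨ P ⟩) → Sub ν ν' ≤ Sub (extend P ν) (extend P ν')
    Sub-extend ν ν' = Sub-intro λ x → *-⋁-least _ λ p →
      ≤-trans (Sub-eval ν ν' (x , p)) (⋁-upper (λ p → ν' (x , p)) p)

    up-extend : {Y : Set} (φ : X → Y → Carrier) (ν : LSet Sub⟨ P ⟩) →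
                up φ (extend P ν) ≈ up (restrX P φ) ν
    up-extend φ ν y = ≤-antisym
      (⋁-least _ _ λ x → ⋁-*-least _ λ p → ⋁-upper (λ x → ν x * restrX P φ x y) (x , p))
      (⋁-least _ _ λ { (x , p) →
        ≤-trans (*-monoˡ-≤ (φ x y) (⋁-upper (λ p → ν (x , p)) p))
                (⋁-upper (λ x → extend P ν x * φ x y) x) })

  module _ {X Y : Set} (φ : X → Y → Carrier) (Q : Y → Set) where

    clo⊑clo-restrY : (μ : LSet X) → clo φ μ ⊑ clo (restrY Q φ) μ
    clo⊑clo-restrY μ x =
      ⋀-greatest _ _ (λ { (y , _) → ⋀-lower (λ y → φ x y ⇒ up φ μ y) y })

    down-restrY-closed : (l : LSet Sub⟨ Q ⟩) → InK φ (down (restrY Q φ) l)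
    down-restrY-closed l = ⊑-antisym
      (begin
        clo φ (down φY' l)           ≤⟨ clo⊑clo-restrY (down φY' l) ⟩
        clo φY' (down φY' l)         ≈⟨ down-closed φY' l ⟩
        down φY' l                   ∎)
      (clo-extensive φ (down φY' l))
      where open ⊑-Reasoning
            φY' = restrY Q φ

  module Reduct {X Y : Set} (φ : X → Y → Carrier) (P : X → Set) (Q : Y → Set) where
    open Maps φ P Q

    φY' : X → Sub⟨ Q ⟩ → Carrier
    φY' = restrY Q φ

    F₁-Surjective : Set
    F₁-Surjective = ∀ μ → InK φ μ → Σ (LSet Sub⟨ P ⟩) λ ν → InK φ' ν × F₁ ν ≈ μ

    ReconstructibleFromX' : Set
    ReconstructibleFromX' = ∀ μ → InK φ μ → F₁ (restrict P μ) ≈ μ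

    ClosedInY' : Set
    ClosedInY' = ∀ μ → InK φ μ → InK φY' μ

    F₁⊑F₂ : (ν : LSet Sub⟨ P ⟩) → F₁ ν ⊑ F₂ ν
    F₁⊑F₂ ν = clo⊑clo-restrY φ Q (extend P ν)

    restrict∘F₂≈clo : (ν : LSet Sub⟨ P ⟩) → restrict P (F₂ ν) ≈ clo φ' ν
    restrict∘F₂≈clo ν (x , _) = down-cong φY' (λ { (y , _) → up-extend P φ ν y }) x

    restrict∘F₁ : {ν : LSet Sub⟨ P ⟩} → InK φ' ν → restrict P (F₁ ν) ≈ ν
    restrict∘F₁ {ν} closed = ⊑-antisym
      (begin
        restrict P (F₁ ν)  ≤⟨ restrict-mono P (F₁⊑F₂ ν) ⟩
        restrict P (F₂ ν)  ≈⟨ restrict∘F₂≈clo ν ⟩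
        clo φ' ν           ≈⟨ closed ⟩
        ν                  ∎)
      (extend-⊑⇒⊑-restrict P (clo-extensive φ (extend P ν)))
      where open ⊑-Reasoning

    F₁∘restrict⊑ : {μ : LSet X} → InK φ μ → F₁ (restrict P μ) ⊑ μ
    F₁∘restrict⊑ {μ} closed = begin
      F₁ (restrict P μ)  ≤⟨ clo-mono φ (extend∘restrict⊑ P μ) ⟩
      clo φ μ            ≈⟨ closed ⟩
      μ                  ∎
      where open ⊑-Reasoning

    restrict-closed : ClosedInY' → {μ : LSet X} → InK φ μ → InK φ' (restrict P μ)
    restrict-closed closedInY' {μ} closed = ⊑-antisym
      (begin
        clo φ' (restrict P μ)           ≈⟨ restrict∘F₂≈clo (restrict P μ) ⟨
        restrict P (F₂ (restrict P μ))  ≤⟨ restrict-mono P (clo-mono φY' (extend∘restrict⊑ P μ)) ⟩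
        restrict P (clo φY' μ)          ≈⟨ restrict-cong P (closedInY' μ closed) ⟩
        restrict P μ                    ∎)
      (clo-extensive φ' (restrict P μ))
      where open ⊑-Reasoning

    closedInY'⇒F₁≈F₂ : ClosedInY' → (ν : LSet Sub⟨ P ⟩) → F₁ ν ≈ F₂ ν
    closedInY'⇒F₁≈F₂ closedInY' ν = ⊑-antisym (F₁⊑F₂ ν) (begin
      F₂ ν             ≤⟨ clo-mono φY' (clo-extensive φ (extend P ν)) ⟩
      clo φY' (F₁ ν)   ≈⟨ closedInY' (F₁ ν) (clo-closed φ (extend P ν)) ⟩
      F₁ ν             ∎)
      where open ⊑-Reasoning

    F₁-isIso : F₁-Surjective → IsIso φ' φ F₁
    F₁-isIso surjective =
        (λ ν _ → clo-closed φ (extend P ν))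
      , (λ ν ν' closed closed' F₁ν≈F₁ν' → begin-equality
          ν                   ≈⟨ restrict∘F₁ closed ⟨
          restrict P (F₁ ν)   ≈⟨ restrict-cong P F₁ν≈F₁ν' ⟩
          restrict P (F₁ ν')  ≈⟨ restrict∘F₁ closed' ⟩
          ν'                  ∎)
      , surjective
      , λ ν ν' closed closed' → ≤-antisym
          (≤-trans (Sub-extend P ν ν') (Sub-clo φ (extend P ν) (extend P ν')))
          (≤-trans (Sub-restrict P (F₁ ν) (F₁ ν'))
                   (≤-reflexive (Sub-cong (restrict∘F₁ closed) (restrict∘F₁ closed'))))
      where open ⊑-Reasoning

    surjective⇒reconstructible : F₁-Surjective → ReconstructibleFromX'
    surjective⇒reconstructible surjective μ closed with surjective μ closed
    ... | ν , closedν , F₁ν≈μ = begin-equality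
      F₁ (restrict P μ)         ≈⟨ clo-cong φ (extend-cong P (restrict-cong P F₁ν≈μ)) ⟨
      F₁ (restrict P (F₁ ν))    ≈⟨ clo-cong φ (extend-cong P (restrict∘F₁ closedν)) ⟩
      F₁ ν                      ≈⟨ F₁ν≈μ ⟩
      μ                         ∎
      where open ⊑-Reasoning

    surjective⇒closedInY' : F₁-Surjective → ClosedInY'
    surjective⇒closedInY' surjective μ closed with surjective μ closed
    ... | ν , closedν , F₁ν≈μ with surjective (F₂ ν) (down-restrY-closed φ Q _)
    ... | ν' , closedν' , F₁ν'≈F₂ν = InK-resp φY' F₂ν≈μ (clo-closed φY' (extend P ν))
      where
      open ⊑-Reasoning
      ν'≈ν : ν' ≈ ν
      ν'≈ν = begin-equality
        ν'                  ≈⟨ restrict∘F₁ closedν' ⟨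
        restrict P (F₁ ν')  ≈⟨ restrict-cong P F₁ν'≈F₂ν ⟩
        restrict P (F₂ ν)   ≈⟨ restrict∘F₂≈clo ν ⟩
        clo φ' ν            ≈⟨ closedν ⟩
        ν                   ∎
      F₂ν≈μ : F₂ ν ≈ μ
      F₂ν≈μ = begin-equality
        F₂ ν    ≈⟨ F₁ν'≈F₂ν ⟨
        F₁ ν'   ≈⟨ clo-cong φ (extend-cong P ν'≈ν) ⟩
        F₁ ν    ≈⟨ F₁ν≈μ ⟩
        μ       ∎

    reconstructible⇒surjective : ReconstructibleFromX' → ClosedInY' → F₁-Surjective
    reconstructible⇒surjective reconstructible closedInY' μ closed =
      restrict P μ , restrict-closed closedInY' closed , reconstructible μ closed

    xReducible⇒reconstructible : XReducible φ P → ReconstructibleFromX'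
    xReducible⇒reconstructible xReducible μ closed with xReducible μ
    ... | ν , upμ≈upν = ⊑-antisym (F₁∘restrict⊑ closed) (begin
        μ                  ≈⟨ μ≈F₁ν ⟩
        F₁ ν               ≤⟨ clo-mono φ (extend-mono P ν⊑μ) ⟩
        F₁ (restrict P μ)  ∎)
      where
      open ⊑-Reasoning
      μ≈F₁ν : μ ≈ F₁ ν
      μ≈F₁ν = begin-equality
        μ                  ≈⟨ closed ⟨
        clo φ μ            ≈⟨ down-cong φ (≈-trans upμ≈upν (≈-sym (up-extend P φ ν))) ⟩
        F₁ ν               ∎
      ν⊑μ : ν ⊑ restrict P μ
      ν⊑μ = extend-⊑⇒⊑-restrict P (begin
        extend P ν  ≤⟨ clo-extensive φ (extend P ν) ⟩
        F₁ ν        ≈⟨ μ≈F₁ν ⟨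
        μ           ∎)

    reconstructible⇒xReducible : ReconstructibleFromX' → XReducible φ P
    reconstructible⇒xReducible reconstructible μ = restrict P (clo φ μ) , (begin-equality
      up φ μ                                        ≈⟨ up∘clo≈up φ μ ⟨
      up φ (clo φ μ)                                ≈⟨ up-cong φ (reconstructible _ (clo-closed φ μ)) ⟨
      up φ (F₁ (restrict P (clo φ μ)))              ≈⟨ up∘clo≈up φ _ ⟩
      up φ (extend P (restrict P (clo φ μ)))        ≈⟨ up-extend P φ _ ⟩
      up (restrX P φ) (restrict P (clo φ μ))        ∎)
      where open ⊑-Reasoning

    yReducible⇒closedInY' : YReducible φ Q → ClosedInY'
    yReducible⇒closedInY' yReducible μ closed with yReducible (up φ μ)
    ... | l , cloμ≈downl = InK-resp φY' (≈-trans (≈-sym cloμ≈downl) closed) (down-closed φY' l)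

    closedInY'⇒yReducible : ClosedInY' → YReducible φ Q
    closedInY'⇒yReducible closedInY' l =
      up φY' (down φ l) , ≈-sym (closedInY' (down φ l) (down-closed φ l))

    S₁-isIso⇒surjective : IsIso φ φ' S₁ → F₁-Surjective
    S₁-isIso⇒surjective (_ , injective , _ , _) μ closed =
      S₁ μ , closedν , injective (F₁ (S₁ μ)) μ (clo-closed φ _) closed (begin-equality
        S₁ (F₁ (S₁ μ))  ≈⟨ clo-cong φ' (restrict∘F₁ closedν) ⟩
        clo φ' (S₁ μ)   ≈⟨ closedν ⟩
        S₁ μ            ∎)
      where
      open ⊑-Reasoning
      closedν : InK φ' (S₁ μ)
      closedν = clo-closed φ' (restrict P μ)

    S₂-isIso⇒closedInY' : IsIso φ φ' S₂ → ClosedInY'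
    S₂-isIso⇒closedInY' (_ , injective , _ , _) μ closed =
      injective (clo φY' μ) μ (down-restrY-closed φ Q _) closed
        (restrict-cong P (clo-closed φY' μ))

    S₂-isIso⇒reconstructible : IsIso φ φ' S₂ → ReconstructibleFromX'
    S₂-isIso⇒reconstructible isIso@(_ , injective , _ , _) μ closed =
      injective (F₁ (restrict P μ)) μ (clo-closed φ _) closed (begin-equality
        S₂ (F₁ (restrict P μ))          ≈⟨ restrict-cong P (closedInY' _ (clo-closed φ _)) ⟩
        restrict P (F₁ (restrict P μ))  ≈⟨ restrict∘F₁ (restrict-closed closedInY' closed) ⟩
        restrict P μ                    ≈⟨ restrict-cong P (closedInY' μ closed) ⟨
        S₂ μ                            ∎)
      where
      open ⊑-Reasoning
      closedInY' : ClosedInY'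
      closedInY' = S₂-isIso⇒closedInY' isIso

    F₂-isIso⇒closedInY' : IsIso φ' φ F₂ → ClosedInY'
    F₂-isIso⇒closedInY' (_ , _ , surjective , _) μ closed with surjective μ closed
    ... | ν , _ , F₂ν≈μ = InK-resp φY' F₂ν≈μ (clo-closed φY' (extend P ν))

    F₂-isIso⇒surjective : IsIso φ' φ F₂ → F₁-Surjective
    F₂-isIso⇒surjective isIso@(_ , _ , surjective , _) μ closed with surjective μ closed
    ... | ν , closedν , F₂ν≈μ =
      ν , closedν , ≈-trans (closedInY'⇒F₁≈F₂ (F₂-isIso⇒closedInY' isIso) ν) F₂ν≈μ

    reconstructible×closedInY'⇒reducible : ReconstructibleFromX' × ClosedInY' →
                                           XReducible φ P × YReducible φ Q
    reconstructible×closedInY'⇒reducible (reconstructible , closedInY') =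
      reconstructible⇒xReducible reconstructible , closedInY'⇒yReducible closedInY'

    surjective⇒reducible : F₁-Surjective → XReducible φ P × YReducible φ Q
    surjective⇒reducible surjective =
      reconstructible×closedInY'⇒reducible
        (surjective⇒reconstructible surjective , surjective⇒closedInY' surjective)

theorem4p9 : (L : CompleteResiduatedLattice) {X Y : Set}
    (φ : X → Y → CompleteResiduatedLattice.Carrier L)
    (P : X → Set) (Q : Y → Set)
    → (∀ x (p q : P x) → p ≡ q) → (∀ y (p q : Q y) → p ≡ q)
    → Context.IsReduct L φ P Q
    ⇔ (Context.XReducible L φ P × Context.YReducible L φ Q)
theorem4p9 L φ P Q _ _ = mk⇔ reduct⇒reducible reducible⇒reduct
  where
  open Reduct L φ P Q

  reduct⇒reducible : Context.IsReduct L φ P Q →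
                     Context.XReducible L φ P × Context.YReducible L φ Q
  reduct⇒reducible (inj₁ S₁-iso) = surjective⇒reducible (S₁-isIso⇒surjective S₁-iso)
  reduct⇒reducible (inj₂ (inj₁ S₂-iso)) =
    reconstructible×closedInY'⇒reducible
      (S₂-isIso⇒reconstructible S₂-iso , S₂-isIso⇒closedInY' S₂-iso)
  reduct⇒reducible (inj₂ (inj₂ (inj₁ (_ , _ , F₁-surjective , _)))) =
    surjective⇒reducible F₁-surjective
  reduct⇒reducible (inj₂ (inj₂ (inj₂ F₂-iso))) =
    surjective⇒reducible (F₂-isIso⇒surjective F₂-iso)

  reducible⇒reduct : Context.XReducible L φ P × Context.YReducible L φ Q →
                     Context.IsReduct L φ P Q
  reducible⇒reduct (xReducible , yReducible) = inj₂ (inj₂ (inj₁ (F₁-isIso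
    (reconstructible⇒surjective (xReducible⇒reconstructible xReducible)
                                (yReducible⇒closedInY' yReducible)))))
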